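{- Let $t\ge1$ and $\pi\in\mathfrak{S}_n(213)$. Then $\pi$ avoids the pattern $23\cdots(t+2)1$ if and only if $\mathsf{lrrp}(\lambda(\pi))\le t$. Consequently, $\mathfrak{S}_n^t(213)=\mathfrak{S}_n(213,\,23\cdots(t+2)1)$.
   Context: $\mathfrak{S}_n(P)$ is the set of permutations of $[n]$ avoiding all patterns in $P$ (no subsequence order-isomorphic to a pattern in $P$); $23\cdots(t+2)1\in\mathfrak{S}_{t+2}$. Stack-sorting: $\mathcal{S}(\emptyset)=\emptyset$, $\mathcal{S}(\alpha\,m\,\beta)=\mathcal{S}(\alpha)\mathcal{S}(\beta)m$ with $m$ the largest letter; $\mathfrak{S}_n^t(213)$ is the set of $\pi\in\mathfrak{S}_n(213)$ with $\mathcal{S}^t(\pi)$ the identity. $\lambda(\emptyset)$ is empty and $\lambda(\sigma\,i\,\tau)$, $i$ the smallest letter, is the binary tree with root $i$, left subtree $\lambda(\sigma)$, right subtree $\lambda(\tau)$. For a binary tree $T$: the right arm is the maximal path from the root using right edges only; a restricted path is a downward path containing no right-arm node; $\mathsf{lrrp}(T)$ is one plus the maximum number of right edges in a restricted path, with $\mathsf{lrrp}(T)=0$ if $T$ has no left edges. -}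

module Defs where

open import Data.Nat using (ℕ; zero; suc; _+_; _<_; _≤_; _⊔_; _⊓_)
open import Data.Nat.Properties using (_≟_)
open import Data.Bool using (Bool; true; false; if_then_else_)
open import Data.List using (List; []; _∷_; _++_; [_]; length; lookup; applyUpTo; foldr)
open import Data.List.Relation.Binary.Sublist.Propositional using (_⊆_)
open import Data.List.Relation.Binary.Permutation.Propositional using (_↭_)
open import Data.Fin using (Fin; cast)
open import Data.Product using (Σ; ∃; _×_; _,_)
open import Relation.Nullary using (¬_; yes; no)
open import Relation.Binary.PropositionalEquality using (_≡_)

idPerm : ℕ → List ℕ
idPerm n = applyUpTo suc n

IsPerm : ℕ → List ℕ → Set
IsPerm n π = π ↭ idPerm n

OrderIso : List ℕ → List ℕ → Set
OrderIso xs ys =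
  Σ (length xs ≡ length ys) λ eq →
    ∀ (i j : Fin (length xs)) →
      (lookup xs i < lookup xs j → lookup ys (cast eq i) < lookup ys (cast eq j)) ×
      (lookup ys (cast eq i) < lookup ys (cast eq j) → lookup xs i < lookup xs j)

Contains : List ℕ → List ℕ → Set
Contains π p = ∃ λ σ → (σ ⊆ π) × OrderIso σ p

Avoids : List ℕ → List ℕ → Set
Avoids π p = ¬ Contains π p

p213 : List ℕ
p213 = 2 ∷ 1 ∷ 3 ∷ []

longPat : ℕ → List ℕ
longPat t = applyUpTo (λ i → i + 2) (suc t) ++ [ 1 ]

splitOn : ℕ → List ℕ → List ℕ × List ℕ
splitOn m [] = [] , []
splitOn m (x ∷ xs) with x ≟ m
... | yes _ = [] , xs
... | no _ with splitOn m xs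
...   | a , b = x ∷ a , b

maxL : ℕ → List ℕ → ℕ
maxL x xs = foldr _⊔_ x xs

minL : ℕ → List ℕ → ℕ
minL x xs = foldr _⊓_ x xs

-- stack-sorting S(α m β) = S(α) S(β) m, m the largest letter.
-- Written with a fuel argument; fuel = length suffices since |α|,|β| < |α m β|.
stackF : ℕ → List ℕ → List ℕ
stackF zero _ = []
stackF (suc k) [] = []
stackF (suc k) (x ∷ xs) with splitOn (maxL x xs) (x ∷ xs)
... | α , β = stackF k α ++ stackF k β ++ [ maxL x xs ]

stackSort : List ℕ → List ℕ
stackSort π = stackF (length π) π

stackIter : ℕ → List ℕ → List ℕ
stackIter zero π = π
stackIter (suc t) π = stackSort (stackIter t π)

data Tree : Set where
  leaf : Tree
  node : Tree → ℕ → Tree → Tree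

lamF : ℕ → List ℕ → Tree
lamF zero _ = leaf
lamF (suc k) [] = leaf
lamF (suc k) (x ∷ xs) with splitOn (minL x xs) (x ∷ xs)
... | σ , τ = node (lamF k σ) (minL x xs) (lamF k τ)

lam : List ℕ → Tree
lam π = lamF (length π) π

-- maximum number of right edges on a downward path starting at the root
maxRootR : Tree → ℕ
maxRootR leaf = 0
maxRootR (node l x leaf) = maxRootR l
maxRootR (node l x (node rl y rr)) = maxRootR l ⊔ suc (maxRootR (node rl y rr))

maxAnyR : Tree → ℕ
maxAnyR leaf = 0
maxAnyR (node l x r) = maxRootR (node l x r) ⊔ maxAnyR l ⊔ maxAnyR r

-- restricted paths are exactly the downward paths lying in the left subtree
-- of some right-arm node; maximum number of right edges over them
restrictedMax : Tree → ℕ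
restrictedMax leaf = 0
restrictedMax (node l x r) = maxAnyR l ⊔ restrictedMax r

hasLeftEdge : Tree → Bool
hasLeftEdge leaf = false
hasLeftEdge (node leaf x r) = hasLeftEdge r
hasLeftEdge (node (node _ _ _) x r) = true

lrrp : Tree → ℕ
lrrp T = if hasLeftEdge T then suc (restrictedMax T) else 0

module Submission where

-- An occurrence of 23⋯(k+2)1 is an ascent y₀ < y₁ < ⋯ < y_k followed later by a letter x < y₀.
-- Stack sorting keeps a letter u ahead of a later letter v exactly when some letter larger than u
-- comes after u and no later than v (that letter pops u before v arrives). Hence every occurrence
-- of 23⋯(k+3)1 in π shrinks to one of 23⋯(k+2)1 in S(π), and conversely when π avoids 3241, a
-- property that 213-avoidance implies and S preserves. Iterating, S^t(π) has no inversion, i.e.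
-- no occurrence of 21, iff π avoids 23⋯(t+2)1.
--
-- If π = σ m τ avoids 213 and m is its least letter, every letter of τ lies below every letter
-- of σ. So an occurrence of 23⋯(t+2)1 in π lies inside σ, inside τ, or is an ascent of σ closed
-- by m; and the longest ascent of π has as many steps as a root path of λ(π) has right edges.
-- Unfolding this along the right arm of λ(π) turns the longest occurrences into restricted paths.

open import Defs
open import Data.Bool using (true; false)
open import Data.Empty using (⊥; ⊥-elim)
open import Data.Fin using (toℕ) renaming (zero to fzero; suc to fsuc)
open import Data.Fin.Properties using (toℕ-cast; toℕ-injective)
open import Data.List using (List; []; _∷_; _++_; [_]; length; foldr; lookup; applyUpTo)
open import Data.List.Properties using (length-applyUpTo; length-++-sucʳ; length-++-≤ˡ; length-++-≤ʳ)
open import Data.List.Membership.Propositional using (_∈_)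
open import Data.List.Membership.Propositional.Properties using (∈-++⁺ˡ; ∈-++⁺ʳ; ∈-++⁻)
open import Data.List.Relation.Binary.Permutation.Propositional using (_↭_; ↭-refl; ↭-sym; ↭-trans; ↭⇒↭ₛ)
open import Data.List.Relation.Binary.Permutation.Propositional.Properties
  using (++-comm; ∈-resp-↭) renaming (++⁺ to ↭-++⁺)
open import Data.List.Relation.Binary.Pointwise using (Pointwise; []; _∷_; Pointwise-≡⇒≡; lookup⁻)
  renaming (++⁺ to Pointwise-++⁺)
open import Data.List.Relation.Binary.Pointwise.Properties using (lookup-cast)
open import Data.List.Relation.Binary.Sublist.Propositional using (_⊆_; _∷_; _∷ʳ_; from∈)
import Data.List.Relation.Binary.Sublist.Propositional as Sublist
open import Data.List.Relation.Binary.Sublist.Heterogeneous.Properties using (∷ˡ⁻)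
open import Data.List.Relation.Unary.Any using (here; there)
open import Data.List.Relation.Unary.All as All using (All; []; _∷_)
open import Data.List.Relation.Unary.All.Properties using (++⁻ˡ; applyUpTo⁺₂)
open import Data.List.Relation.Unary.AllPairs as AllPairs using (AllPairs; []; _∷_)
import Data.List.Relation.Unary.AllPairs.Properties as AllPairs
open import Data.List.Relation.Unary.Sorted.TotalOrder using (Sorted)
open import Data.List.Relation.Unary.Sorted.TotalOrder.Properties using (AllPairs⇒Sorted; ↗↭↗⇒≋)
open import Data.List.Relation.Unary.Unique.Propositional using (Unique)
open import Data.List.Relation.Unary.Unique.Propositional.Properties using (Unique[x∷xs]⇒x∉xs)
open import Data.Nat using (ℕ; zero; suc; pred; _+_; _≤_; _<_; _⊔_; z≤n; s≤s; z<s; s<s)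
open import Data.Nat.Properties
  using ( _≟_; ≤-refl; ≤-trans; ≤-reflexive; <-trans; <-asym; <-irrefl; <-cmp; <⇒≤; <⇒≢; <⇒≱; ≰⇒>
        ; ≤∧≢⇒<; ≤⇒≯; m≤n⇒m<n∨m≡n; ≤-totalOrder; +-suc; +-identityʳ; +-monoˡ-<; m≤n+m
        ; ⊔-sel; ⊓-sel; m≤m⊔n; m≤n⊔m; m≤n⇒m≤n⊔o; m≤n⇒m≤o⊔n; m⊓n≤m; m⊓n≤n)
open import Data.Product using (_×_; _,_; ∃; ∃₂; proj₁; proj₂; swap)
import Data.Sum as Sum
open import Data.Sum using (_⊎_; inj₁; inj₂)
open import Function using (flip)
open import Function.Bundles using (_⇔_; mk⇔; Equivalence)
import Function.Properties.Equivalence as ⇔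
open import Level using (0ℓ)
open import Relation.Binary.Definitions using (tri<; tri≈; tri>)
open import Relation.Binary.PropositionalEquality
  using (_≡_; _≢_; refl; sym; trans; cong; subst; setoid)
open import Relation.Nullary using (¬_; yes; no; contraposition)
import Data.List.Relation.Binary.Permutation.Setoid.Properties (setoid ℕ) as Permutationₛ
open import Algebra.Definitions {A = ℕ} _≡_ using (Selective)
open import Relation.Binary.Reasoning.Setoid (⇔.⇔-setoid 0ℓ) using (begin_; step-≈-⟩; step-≈-⟨; step-≡-⟩; _∎)

variable
  u v w x y z m k x′ y′ : ℕ
  xs ys ws α β : List ℕ
  P Q : ℕ → Set

foldr-selective-∈ : ∀ {f} → Selective f → ∀ x xs → foldr f x xs ∈ x ∷ xs
foldr-selective-∈ sel x [] = here refl
foldr-selective-∈ {f} sel x (y ∷ ys) with sel y (foldr f x ys)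
... | inj₁ e = there (here e)
... | inj₂ e with foldr-selective-∈ sel x ys
...   | here e′ = here (trans e e′)
...   | there r∈ = there (there (subst (_∈ ys) (sym e) r∈))

module _ {f : ℕ → ℕ → ℕ} {R : ℕ → ℕ → Set}
         (R-refl : ∀ {a} → R a a) (R-trans : ∀ {a b c} → R a b → R b c → R a c)
         (boundˡ : ∀ a b → R a (f a b)) (boundʳ : ∀ a b → R b (f a b)) where

  foldr-bounds : ∀ x xs → All (λ y → R y (foldr f x xs)) (x ∷ xs)
  foldr-bounds x [] = R-refl ∷ []
  foldr-bounds x (y ∷ ys) with foldr-bounds x ys
  ... | Rx ∷ Rys = R-trans Rx (boundʳ y _) ∷ boundˡ y _ ∷ All.map (λ r → R-trans r (boundʳ y _)) Rys

maxL-upper : ∀ x xs → All (_≤ maxL x xs) (x ∷ xs)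
maxL-upper = foldr-bounds ≤-refl ≤-trans m≤m⊔n m≤n⊔m

minL-lower : ∀ x xs → All (minL x xs ≤_) (x ∷ xs)
minL-lower = foldr-bounds {R = flip _≤_} ≤-refl (flip ≤-trans) m⊓n≤m m⊓n≤n

splitOn-pivot : m ∈ xs → xs ≡ proj₁ (splitOn m xs) ++ m ∷ proj₂ (splitOn m xs)
splitOn-pivot {m} {x ∷ xs} m∈ with x ≟ m
... | yes refl = refl
... | no x≢m with m∈
...   | here m≡x = ⊥-elim (x≢m (sym m≡x))
...   | there m∈xs = cong (x ∷_) (splitOn-pivot m∈xs)

length-around-pivot : length (α ++ m ∷ β) ≤ suc k → length α ≤ k × length β ≤ k
length-around-pivot {α} {m} {β} len with ≤-trans (≤-reflexive (sym (length-++-sucʳ α m β))) len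
... | s≤s len′ = ≤-trans (length-++-≤ˡ α) len′ , ≤-trans (length-++-≤ʳ β {α}) len′

splitOn-shorter : m ∈ xs → length xs ≤ suc k →
                  length (proj₁ (splitOn m xs)) ≤ k × length (proj₂ (splitOn m xs)) ≤ k
splitOn-shorter {m} {xs} {k} m∈ len =
  length-around-pivot {α = proj₁ (splitOn m xs)} {β = proj₂ (splitOn m xs)}
                      (subst (λ ys → length ys ≤ suc k) (splitOn-pivot m∈) len)

data IsStackSort : List ℕ → List ℕ → Set where
  [] : IsStackSort [] []
  pivot : ∀ {xs α m β α′ β′} → xs ≡ α ++ m ∷ β → All (_≤ m) xs →
          IsStackSort α α′ → IsStackSort β β′ → IsStackSort xs (α′ ++ β′ ++ [ m ])

data IsMinTree : List ℕ → Tree → Set where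
  leaf : IsMinTree [] leaf
  node : ∀ {xs α m β L R} → xs ≡ α ++ m ∷ β → All (m ≤_) xs →
         IsMinTree α L → IsMinTree β R → IsMinTree xs (node L m R)

stackF-isStackSort : ∀ k xs → length xs ≤ k → IsStackSort xs (stackF k xs)
stackF-isStackSort zero [] _ = []
stackF-isStackSort (suc k) [] _ = []
stackF-isStackSort (suc k) (x ∷ xs) len =
  pivot (splitOn-pivot max∈) (maxL-upper x xs)
        (stackF-isStackSort k σ (proj₁ shorter)) (stackF-isStackSort k τ (proj₂ shorter))
  where
  max∈ : maxL x xs ∈ x ∷ xs
  max∈ = foldr-selective-∈ ⊔-sel x xs
  σ τ : List ℕ
  σ = proj₁ (splitOn (maxL x xs) (x ∷ xs))
  τ = proj₂ (splitOn (maxL x xs) (x ∷ xs))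
  shorter : length σ ≤ k × length τ ≤ k
  shorter = splitOn-shorter max∈ len

lamF-isMinTree : ∀ k xs → length xs ≤ k → IsMinTree xs (lamF k xs)
lamF-isMinTree zero [] _ = leaf
lamF-isMinTree (suc k) [] _ = leaf
lamF-isMinTree (suc k) (x ∷ xs) len =
  node (splitOn-pivot min∈) (minL-lower x xs)
       (lamF-isMinTree k σ (proj₁ shorter)) (lamF-isMinTree k τ (proj₂ shorter))
  where
  min∈ : minL x xs ∈ x ∷ xs
  min∈ = foldr-selective-∈ ⊓-sel x xs
  σ τ : List ℕ
  σ = proj₁ (splitOn (minL x xs) (x ∷ xs))
  τ = proj₂ (splitOn (minL x xs) (x ∷ xs))
  shorter : length σ ≤ k × length τ ≤ k
  shorter = splitOn-shorter min∈ len

stackSort-isStackSort : ∀ xs → IsStackSort xs (stackSort xs)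
stackSort-isStackSort xs = stackF-isStackSort (length xs) xs ≤-refl

lam-isMinTree : ∀ xs → IsMinTree xs (lam xs)
lam-isMinTree xs = lamF-isMinTree (length xs) xs ≤-refl

data Before : List ℕ → ℕ → ℕ → Set where
  first : ∀ {u v xs} → v ∈ xs → Before (u ∷ xs) u v
  later : ∀ {x u v xs} → Before xs u v → Before (x ∷ xs) u v

Before⇒∈ˡ : Before xs u v → u ∈ xs
Before⇒∈ˡ (first _) = here refl
Before⇒∈ˡ (later b) = there (Before⇒∈ˡ b)

Before⇒∈ʳ : Before xs u v → v ∈ xs
Before⇒∈ʳ (first v∈) = there v∈
Before⇒∈ʳ (later b) = there (Before⇒∈ʳ b)

Before-trans : Unique xs → Before xs u v → Before xs v w → Before xs u w
Before-trans _ (first _) (first w∈) = first w∈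
Before-trans _ (first _) (later b) = first (Before⇒∈ʳ b)
Before-trans U (later b) (first _) = ⊥-elim (Unique[x∷xs]⇒x∉xs U (Before⇒∈ʳ b))
Before-trans (_ ∷ U) (later b) (later b′) = later (Before-trans U b b′)

Before-irrefl : Unique xs → ¬ Before xs u u
Before-irrefl U (first u∈) = Unique[x∷xs]⇒x∉xs U u∈
Before-irrefl (_ ∷ U) (later b) = Before-irrefl U b

Before-total : u ∈ xs → v ∈ xs → u ≢ v → Before xs u v ⊎ Before xs v u
Before-total (here refl) (here refl) u≢v = ⊥-elim (u≢v refl)
Before-total (here refl) (there v∈) _ = inj₁ (first v∈)
Before-total (there u∈) (here refl) _ = inj₂ (first u∈)
Before-total (there u∈) (there v∈) u≢v with Before-total u∈ v∈ u≢v
... | inj₁ b = inj₁ (later b)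
... | inj₂ b = inj₂ (later b)

module _ {R : ℕ → ℕ → Set} where

  AllPairs⇔Before : AllPairs R xs ⇔ (∀ {u v} → Before xs u v → R u v)
  AllPairs⇔Before = mk⇔ to from
    where
    to : ∀ {xs} → AllPairs R xs → ∀ {u v} → Before xs u v → R u v
    to (Rx ∷ _) (first v∈) = All.lookup Rx v∈
    to (_ ∷ Rxs) (later b) = to Rxs b
    from : ∀ {xs} → (∀ {u v} → Before xs u v → R u v) → AllPairs R xs
    from {[]} _ = []
    from {x ∷ xs} R′ = All.tabulate (λ v∈ → R′ (first v∈)) ∷ from (λ b → R′ (later b))

Before-++⁺ˡ : Before xs u v → Before (xs ++ ys) u v
Before-++⁺ˡ (first v∈) = first (∈-++⁺ˡ v∈)
Before-++⁺ˡ (later b) = later (Before-++⁺ˡ b)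

Before-++⁺ʳ : ∀ xs → Before ys u v → Before (xs ++ ys) u v
Before-++⁺ʳ [] b = b
Before-++⁺ʳ (_ ∷ xs) b = later (Before-++⁺ʳ xs b)

Before-++⁺ : u ∈ xs → v ∈ ys → Before (xs ++ ys) u v
Before-++⁺ {xs = _ ∷ xs} (here refl) v∈ = first (∈-++⁺ʳ xs v∈)
Before-++⁺ (there u∈) v∈ = later (Before-++⁺ u∈ v∈)

Before-++⁻ : ∀ xs → Before (xs ++ ys) u v → Before xs u v ⊎ (u ∈ xs × v ∈ ys) ⊎ Before ys u v
Before-++⁻ [] b = inj₂ (inj₂ b)
Before-++⁻ (_ ∷ xs) (first v∈) with ∈-++⁻ xs v∈
... | inj₁ v∈xs = inj₁ (first v∈xs)
... | inj₂ v∈ys = inj₂ (inj₁ (here refl , v∈ys))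
Before-++⁻ (_ ∷ xs) (later b) with Before-++⁻ xs b
... | inj₁ b′ = inj₁ (later b′)
... | inj₂ (inj₁ (u∈ , v∈)) = inj₂ (inj₁ (there u∈ , v∈))
... | inj₂ (inj₂ b′) = inj₂ (inj₂ b′)

Unique-++⁻ˡ : ∀ xs → Unique (xs ++ ys) → Unique xs
Unique-++⁻ˡ [] _ = []
Unique-++⁻ˡ (_ ∷ xs) (x∉ ∷ U) = ++⁻ˡ xs x∉ ∷ Unique-++⁻ˡ xs U

Unique-++⁻ʳ : ∀ xs → Unique (xs ++ ys) → Unique ys
Unique-++⁻ʳ [] U = U
Unique-++⁻ʳ (_ ∷ xs) (_ ∷ U) = Unique-++⁻ʳ xs U

Unique-++-disjoint : ∀ xs → Unique (xs ++ ys) → u ∈ xs → u ∈ ys → ⊥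
Unique-++-disjoint (_ ∷ xs) U (here refl) u∈ys = Unique[x∷xs]⇒x∉xs U (∈-++⁺ʳ xs u∈ys)
Unique-++-disjoint (_ ∷ xs) (_ ∷ U) (there u∈xs) u∈ys = Unique-++-disjoint xs U u∈xs u∈ys

Before-restrictˡ : ∀ xs → Unique (xs ++ ys) → Before (xs ++ ys) u v → v ∈ xs → Before xs u v
Before-restrictˡ xs U b v∈ with Before-++⁻ xs b
... | inj₁ b′ = b′
... | inj₂ (inj₁ (_ , v∈ys)) = ⊥-elim (Unique-++-disjoint xs U v∈ v∈ys)
... | inj₂ (inj₂ b′) = ⊥-elim (Unique-++-disjoint xs U v∈ (Before⇒∈ʳ b′))

Before-restrictʳ : ∀ xs → Unique (xs ++ ys) → Before (xs ++ ys) u v → u ∈ ys → Before ys u v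
Before-restrictʳ xs U b u∈ with Before-++⁻ xs b
... | inj₁ b′ = ⊥-elim (Unique-++-disjoint xs U (Before⇒∈ˡ b′) u∈)
... | inj₂ (inj₁ (u∈xs , _)) = ⊥-elim (Unique-++-disjoint xs U u∈xs u∈)
... | inj₂ (inj₂ b′) = b′

LargerBetween : List ℕ → ℕ → ℕ → Set
LargerBetween xs u v = ∃ λ z → u < z × Before xs u z × (z ≡ v ⊎ Before xs z v)

LargerBetween-map : (∀ {a b} → Before xs a b → Before ys a b) → LargerBetween xs u v → LargerBetween ys u v
LargerBetween-map f (z , u<z , u≺z , inj₁ z≡v) = z , u<z , f u≺z , inj₁ z≡v
LargerBetween-map f (z , u<z , u≺z , inj₂ z≺v) = z , u<z , f u≺z , inj₂ (f z≺v)

module AroundPivot (α : List ℕ) (m : ℕ) (β : List ℕ) (U : Unique (α ++ m ∷ β)) where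

  Uα : Unique α
  Uα = Unique-++⁻ˡ α U

  Uβ : Unique β
  Uβ = AllPairs.tail (Unique-++⁻ʳ α U)

  m∉α : u ∈ α → u ≢ m
  m∉α u∈ refl = Unique-++-disjoint α U u∈ (here refl)

  m∉β : u ∈ β → u ≢ m
  m∉β u∈ refl = Unique[x∷xs]⇒x∉xs (Unique-++⁻ʳ α U) u∈

  ∈-split : u ∈ α ++ m ∷ β → u ∈ α ⊎ u ≡ m ⊎ u ∈ β
  ∈-split u∈ with ∈-++⁻ α u∈
  ... | inj₁ u∈α = inj₁ u∈α
  ... | inj₂ (here u≡m) = inj₂ (inj₁ u≡m)
  ... | inj₂ (there u∈β) = inj₂ (inj₂ u∈β)

  liftˡ : Before α u v → Before (α ++ m ∷ β) u v
  liftˡ = Before-++⁺ˡ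

  liftʳ : Before β u v → Before (α ++ m ∷ β) u v
  liftʳ b = Before-++⁺ʳ α (later b)

  restrictˡ : Before (α ++ m ∷ β) u v → v ∈ α → Before α u v
  restrictˡ = Before-restrictˡ α U

  restrictʳ : Before (α ++ m ∷ β) u v → u ∈ β → Before β u v
  restrictʳ b u∈ with Before-restrictʳ α U b (there u∈)
  ... | first _ = ⊥-elim (m∉β u∈ refl)
  ... | later b′ = b′

  Before-pivot⇒∈ˡ : Before (α ++ m ∷ β) u m → u ∈ α
  Before-pivot⇒∈ˡ b with ∈-split (Before⇒∈ˡ b)
  ... | inj₁ u∈α = u∈α
  ... | inj₂ (inj₁ refl) = ⊥-elim (Before-irrefl U b)
  ... | inj₂ (inj₂ u∈β) = ⊥-elim (Before-irrefl U (Before-trans U (Before-++⁺ʳ α (first u∈β)) b))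

  pivot-Before⇒∈ʳ : Before (α ++ m ∷ β) m u → u ∈ β
  pivot-Before⇒∈ʳ b with ∈-split (Before⇒∈ʳ b)
  ... | inj₁ u∈α = ⊥-elim (Before-irrefl U (Before-trans U b (Before-++⁺ u∈α (here refl))))
  ... | inj₂ (inj₁ refl) = ⊥-elim (Before-irrefl U b)
  ... | inj₂ (inj₂ u∈β) = u∈β

  LargerBetween-restrictˡ : LargerBetween (α ++ m ∷ β) u v → v ∈ α → LargerBetween α u v
  LargerBetween-restrictˡ (z , u<z , u≺z , inj₁ refl) v∈ = z , u<z , restrictˡ u≺z v∈ , inj₁ refl
  LargerBetween-restrictˡ (z , u<z , u≺z , inj₂ z≺v) v∈ =
    let z≺v′ = restrictˡ z≺v v∈ in z , u<z , restrictˡ u≺z (Before⇒∈ˡ z≺v′) , inj₂ z≺v′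

  LargerBetween-restrictʳ : LargerBetween (α ++ m ∷ β) u v → u ∈ β → LargerBetween β u v
  LargerBetween-restrictʳ (z , u<z , u≺z , inj₁ refl) u∈ = z , u<z , restrictʳ u≺z u∈ , inj₁ refl
  LargerBetween-restrictʳ (z , u<z , u≺z , inj₂ z≺v) u∈ =
    let u≺z′ = restrictʳ u≺z u∈ in z , u<z , u≺z′ , inj₂ (restrictʳ z≺v (Before⇒∈ʳ u≺z′))

isStackSort-↭ : IsStackSort xs ys → ys ↭ xs
isStackSort-↭ [] = ↭-refl
isStackSort-↭ (pivot {m = m} {β = β} refl _ sα sβ) =
  ↭-++⁺ (isStackSort-↭ sα) (↭-trans (↭-++⁺ (isStackSort-↭ sβ) ↭-refl) (++-comm β [ m ]))

∈-isStackSort : IsStackSort xs ys → u ∈ xs → u ∈ ys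
∈-isStackSort s = ∈-resp-↭ (↭-sym (isStackSort-↭ s))

∈-isStackSort⁻ : IsStackSort xs ys → u ∈ ys → u ∈ xs
∈-isStackSort⁻ s = ∈-resp-↭ (isStackSort-↭ s)

maximum-not-overtaken : All (_≤ m) xs → ¬ LargerBetween xs m v
maximum-not-overtaken bound (_ , m<z , m≺z , _) = ≤⇒≯ (All.lookup bound (Before⇒∈ʳ m≺z)) m<z

stackSort-Before⁺ : Unique xs → IsStackSort xs ys → Before xs u v → LargerBetween xs u v → Before ys u v
stackSort-Before⁺ U [] () _
stackSort-Before⁺ {u = u} {v = v} U (pivot {α = α} {m} {β} {α′} {β′} refl bound sα sβ) u≺v lb =
  go (Before-++⁻ α u≺v)
  where
  open AroundPivot α m β U
  go : Before α u v ⊎ (u ∈ α × v ∈ m ∷ β) ⊎ Before (m ∷ β) u v → Before (α′ ++ β′ ++ [ m ]) u v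
  go (inj₁ b) = Before-++⁺ˡ (stackSort-Before⁺ Uα sα b (LargerBetween-restrictˡ lb (Before⇒∈ʳ b)))
  go (inj₂ (inj₁ (u∈α , here refl))) = Before-++⁺ (∈-isStackSort sα u∈α) (∈-++⁺ʳ β′ (here refl))
  go (inj₂ (inj₁ (u∈α , there v∈β))) = Before-++⁺ (∈-isStackSort sα u∈α) (∈-++⁺ˡ (∈-isStackSort sβ v∈β))
  go (inj₂ (inj₂ (first _))) = ⊥-elim (maximum-not-overtaken bound lb)
  go (inj₂ (inj₂ (later b))) =
    Before-++⁺ʳ α′ (Before-++⁺ˡ (stackSort-Before⁺ Uβ sβ b (LargerBetween-restrictʳ lb (Before⇒∈ˡ b))))

stackSort-Before⁻ : Unique xs → IsStackSort xs ys → Before ys u v →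
                    (Before xs u v × LargerBetween xs u v) ⊎ (Before xs v u × ¬ LargerBetween xs v u)
stackSort-Before⁻ U [] ()
stackSort-Before⁻ {u = u} {v = v} U (pivot {α = α} {m} {β} {α′} {β′} refl bound sα sβ) u≺v =
  go (Before-++⁻ α′ u≺v)
  where
  open AroundPivot α m β U
  Outcome : List ℕ → Set
  Outcome xs = (Before xs u v × LargerBetween xs u v) ⊎ (Before xs v u × ¬ LargerBetween xs v u)
  liftˡ-outcome : Outcome α → Outcome (α ++ m ∷ β)
  liftˡ-outcome (inj₁ (b , lb)) = inj₁ (liftˡ b , LargerBetween-map liftˡ lb)
  liftˡ-outcome (inj₂ (b , ¬lb)) = inj₂ (liftˡ b , λ lb → ¬lb (LargerBetween-restrictˡ lb (Before⇒∈ʳ b)))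
  liftʳ-outcome : Outcome β → Outcome (α ++ m ∷ β)
  liftʳ-outcome (inj₁ (b , lb)) = inj₁ (liftʳ b , LargerBetween-map liftʳ lb)
  liftʳ-outcome (inj₂ (b , ¬lb)) = inj₂ (liftʳ b , λ lb → ¬lb (LargerBetween-restrictʳ lb (Before⇒∈ˡ b)))
  below-pivot : u ∈ α → u < m
  below-pivot u∈α = ≤∧≢⇒< (All.lookup bound (∈-++⁺ˡ u∈α)) (m∉α u∈α)
  go : Before α′ u v ⊎ (u ∈ α′ × v ∈ β′ ++ [ m ]) ⊎ Before (β′ ++ [ m ]) u v → Outcome (α ++ m ∷ β)
  go (inj₁ b) = liftˡ-outcome (stackSort-Before⁻ Uα sα b)
  go (inj₂ (inj₁ (u∈α′ , v∈))) with ∈-isStackSort⁻ sα u∈α′ | ∈-++⁻ β′ v∈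
  ... | u∈α | inj₁ v∈β′ =
    inj₁ (Before-++⁺ u∈α (there v∈β) ,
          m , below-pivot u∈α , Before-++⁺ u∈α (here refl) , inj₂ (Before-++⁺ʳ α (first v∈β)))
    where
    v∈β : v ∈ β
    v∈β = ∈-isStackSort⁻ sβ v∈β′
  ... | u∈α | inj₂ (here refl) =
    inj₁ (Before-++⁺ u∈α (here refl) , m , below-pivot u∈α , Before-++⁺ u∈α (here refl) , inj₁ refl)
  go (inj₂ (inj₂ b)) with Before-++⁻ β′ b
  ... | inj₁ b′ = liftʳ-outcome (stackSort-Before⁻ Uβ sβ b′)
  ... | inj₂ (inj₁ (u∈β′ , here refl)) =
    inj₂ (Before-++⁺ʳ α (first (∈-isStackSort⁻ sβ u∈β′)) , maximum-not-overtaken bound)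
  ... | inj₂ (inj₂ (first ()))
  ... | inj₂ (inj₂ (later ()))

data Ascent (xs : List ℕ) (P : ℕ → Set) : ℕ → ℕ → Set where
  done : ∀ {y} → P y → Ascent xs P 0 y
  step : ∀ {k y y′} → y < y′ → Before xs y y′ → Ascent xs P k y′ → Ascent xs P (suc k) y

Precedes : List ℕ → ℕ → ℕ → Set
Precedes xs x z = Before xs z x

HasLongPat : List ℕ → ℕ → Set
HasLongPat xs k = ∃ λ x → ∃ λ y → x < y × Ascent xs (Precedes xs x) k y

HasAscent : List ℕ → ℕ → Set
HasAscent xs k = ∃ λ y → Ascent xs (_∈ xs) k y

Ascent-map : (∀ {a b} → Before xs a b → Before ys a b) → (∀ {z} → P z → Q z) →
             Ascent xs P k y → Ascent ys Q k y
Ascent-map f g (done p) = done (g p)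
Ascent-map f g (step y<y′ y≺y′ rest) = step y<y′ (f y≺y′) (Ascent-map f g rest)

Ascent-head : (∀ {z} → P z → z ∈ xs) → Ascent xs P k y → y ∈ xs
Ascent-head g (done p) = g p
Ascent-head g (step _ y≺y′ _) = Before⇒∈ˡ y≺y′

HasAscent-[] : ¬ HasAscent [] k
HasAscent-[] (_ , done ())
HasAscent-[] (_ , step _ () _)

HasLongPat-[] : ¬ HasLongPat [] k
HasLongPat-[] (_ , _ , _ , done ())
HasLongPat-[] (_ , _ , _ , step _ () _)

HasAscent-pred : HasAscent xs (suc k) → HasAscent xs k
HasAscent-pred (_ , step _ _ rest) = _ , rest

HasAscent-≤ : m ≤ k → HasAscent xs k → HasAscent xs m
HasAscent-≤ m≤k a with m≤n⇒m<n∨m≡n m≤k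
... | inj₂ refl = a
... | inj₁ (s≤s m≤k′) = HasAscent-≤ m≤k′ (HasAscent-pred a)

No3241 : List ℕ → Set
No3241 xs = ∀ {a b c d} → Before xs c b → Before xs b d → Before xs d a → a < b → b < c → c < d → ⊥

No213 : List ℕ → Set
No213 xs = ∀ {a b c} → Before xs a b → Before xs b c → b < a → a < c → ⊥

No213⇒No3241 : No213 xs → No3241 xs
No213⇒No3241 no213 c≺b b≺d _ _ b<c c<d = no213 c≺b b≺d b<c c<d

Ascent-last : Unique xs → Ascent xs (Precedes xs x) k y → Before xs y x
Ascent-last U (done y≺x) = y≺x
Ascent-last U (step _ y≺y′ rest) = Before-trans U y≺y′ (Ascent-last U rest)

Ascent-stackSort⁺ : Unique xs → IsStackSort xs ys →
                    Ascent xs (Precedes xs x) (suc k) y → Ascent ys (Precedes ys x) k y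
Ascent-stackSort⁺ U s (step y<y′ y≺y′ (done y′≺x)) =
  done (stackSort-Before⁺ U s (Before-trans U y≺y′ y′≺x) (_ , y<y′ , y≺y′ , inj₂ y′≺x))
Ascent-stackSort⁺ U s (step y<y′ y≺y′ rest@(step _ _ _)) =
  step y<y′ (stackSort-Before⁺ U s y≺y′ (_ , y<y′ , y≺y′ , inj₁ refl)) (Ascent-stackSort⁺ U s rest)

Ascent-stackSort⁻ : Unique xs → No3241 xs → IsStackSort xs ys →
                    Ascent ys (Precedes ys x) k y → x < y → Ascent xs (Precedes xs x) (suc k) y
Ascent-stackSort⁻ U no3241 s (done y≺x) x<y with stackSort-Before⁻ U s y≺x
... | inj₁ (_ , z , y<z , y≺z , inj₁ refl) = ⊥-elim (<-asym x<y y<z)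
... | inj₁ (_ , z , y<z , y≺z , inj₂ z≺x) = step y<z y≺z (done z≺x)
... | inj₂ (x≺y , ¬lb) = ⊥-elim (¬lb (_ , x<y , x≺y , inj₁ refl))
Ascent-stackSort⁻ U no3241 s (step y<y′ y≺y′ rest) x<y
  with Ascent-stackSort⁻ U no3241 s rest (<-trans x<y y<y′) | stackSort-Before⁻ U s y≺y′
... | rest′ | inj₁ (y≺y′ , _) = step y<y′ y≺y′ rest′
... | step {y′ = w} y′<w y′≺w restʷ | inj₂ (y′≺y , ¬lb)
  with Before-total (Before⇒∈ʳ y′≺y) (Before⇒∈ʳ y′≺w) (λ y≡w → <-irrefl y≡w (<-trans y<y′ y′<w))
...   | inj₁ y≺w = ⊥-elim (no3241 y′≺y y≺w (Ascent-last U restʷ) x<y y<y′ y′<w)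
...   | inj₂ w≺y = ⊥-elim (¬lb (w , y′<w , y′≺w , inj₂ w≺y))

No3241-stackSort : Unique xs → No3241 xs → IsStackSort xs ys → No3241 ys
No3241-stackSort U no3241 s {a} {b} {c} {d} c≺b b≺d d≺a a<b b<c c<d
  with stackSort-Before⁻ U s c≺b | stackSort-Before⁻ U s d≺a
... | inj₂ (b≺c , ¬lb) | _ = ¬lb (c , b<c , b≺c , inj₁ refl)
... | _ | inj₂ (a≺d , ¬lb) = ¬lb (d , <-trans a<b (<-trans b<c c<d) , a≺d , inj₁ refl)
... | _ | inj₁ (_ , w , d<w , d≺w , inj₁ refl) = <-asym d<w (<-trans a<b (<-trans b<c c<d))
... | inj₁ (c≺b , _) | inj₁ (_ , w , d<w , d≺w , inj₂ w≺a) with stackSort-Before⁻ U s b≺d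
...   | inj₁ (b≺d , _) = no3241 c≺b (Before-trans U b≺d d≺w) w≺a a<b b<c (<-trans c<d d<w)
...   | inj₂ (d≺b , ¬lb)
  with Before-total (Before⇒∈ʳ d≺b) (Before⇒∈ʳ d≺w) (λ b≡w → <-irrefl b≡w (<-trans b<c (<-trans c<d d<w)))
...     | inj₁ b≺w = no3241 c≺b b≺w w≺a a<b b<c (<-trans c<d d<w)
...     | inj₂ w≺b = ¬lb (w , d<w , d≺w , inj₂ w≺b)

HasLongPat-stackSort : Unique xs → No3241 xs → IsStackSort xs ys → HasLongPat ys k ⇔ HasLongPat xs (suc k)
HasLongPat-stackSort U no3241 s = mk⇔
  (λ (x , y , x<y , asc) → x , y , x<y , Ascent-stackSort⁻ U no3241 s asc x<y)
  (λ (x , y , x<y , asc) → x , y , x<y , Ascent-stackSort⁺ U s asc)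

Unique-resp-↭ : xs ↭ ys → Unique xs → Unique ys
Unique-resp-↭ p = Permutationₛ.Unique-resp-↭ (↭⇒↭ₛ p)

stackIter-↭ : ∀ t xs → stackIter t xs ↭ xs
stackIter-↭ zero xs = ↭-refl
stackIter-↭ (suc t) xs = ↭-trans (isStackSort-↭ (stackSort-isStackSort (stackIter t xs))) (stackIter-↭ t xs)

Unique-stackIter : ∀ t → Unique xs → Unique (stackIter t xs)
Unique-stackIter {xs} t = Unique-resp-↭ (↭-sym (stackIter-↭ t xs))

No3241-stackIter : ∀ t → Unique xs → No3241 xs → No3241 (stackIter t xs)
No3241-stackIter zero U no3241 = no3241
No3241-stackIter (suc t) U no3241 =
  No3241-stackSort (Unique-stackIter t U) (No3241-stackIter t U no3241) (stackSort-isStackSort _)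

HasLongPat-stackIter : ∀ t → Unique xs → No3241 xs → HasLongPat (stackIter t xs) k ⇔ HasLongPat xs (t + k)
HasLongPat-stackIter zero U no3241 = ⇔.refl
HasLongPat-stackIter {k = k} (suc t) U no3241 rewrite sym (+-suc t k) =
  ⇔.trans (HasLongPat-stackSort (Unique-stackIter t U) (No3241-stackIter t U no3241) (stackSort-isStackSort _))
          (HasLongPat-stackIter t U no3241)

idPerm-ascending : ∀ n → AllPairs _<_ (idPerm n)
idPerm-ascending n = AllPairs.applyUpTo⁺₁ suc n (λ i<j _ → s≤s i<j)

Unique-idPerm : ∀ n → Unique (idPerm n)
Unique-idPerm n = AllPairs.map <⇒≢ (idPerm-ascending n)

≡idPerm⇔¬HasLongPat : ∀ n → xs ↭ idPerm n → xs ≡ idPerm n ⇔ (¬ HasLongPat xs 0)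
≡idPerm⇔¬HasLongPat {xs} n p = mk⇔ identity⇒ ⇒identity
  where
  identity⇒ : xs ≡ idPerm n → ¬ HasLongPat xs 0
  identity⇒ refl (x , y , x<y , done y≺x) = <-asym x<y (Equivalence.to AllPairs⇔Before (idPerm-ascending n) y≺x)
  ⇒identity : ¬ HasLongPat xs 0 → xs ≡ idPerm n
  ⇒identity ¬inversion =
    Pointwise-≡⇒≡ (↗↭↗⇒≋ ≤-totalOrder (ascending⇒sorted (Equivalence.from AllPairs⇔Before ordered))
                                      (ascending⇒sorted (idPerm-ascending n)) (↭⇒↭ₛ p))
    where
    ascending⇒sorted : AllPairs _<_ ys → Sorted ≤-totalOrder ys
    ascending⇒sorted ys↑ = AllPairs⇒Sorted ≤-totalOrder (AllPairs.map <⇒≤ ys↑)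
    ordered : Before xs u v → u < v
    ordered {u} {v} u≺v with <-cmp u v
    ... | tri< u<v _ _ = u<v
    ... | tri≈ _ refl _ = ⊥-elim (Before-irrefl (Unique-resp-↭ (↭-sym p) (Unique-idPerm n)) u≺v)
    ... | tri> _ _ v<u = ⊥-elim (¬inversion (v , u , v<u , done u≺v))

Concordant : ℕ → ℕ → ℕ → ℕ → Set
Concordant x y x′ y′ =
  ((x < x′ → y < y′) × (y < y′ → x < x′)) × ((x′ < x → y′ < y) × (y′ < y → x′ < x))

concordant-< : x < x′ → y < y′ → Concordant x y x′ y′
concordant-< x<x′ y<y′ =
  ((λ _ → y<y′) , (λ _ → x<x′)) ,
  ((λ x′<x → ⊥-elim (<-asym x<x′ x′<x)) , (λ y′<y → ⊥-elim (<-asym y<y′ y′<y)))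

concordant-> : x′ < x → y′ < y → Concordant x y x′ y′
concordant-> x′<x y′<y = swap (concordant-< x′<x y′<y)

Pointwise-++⁻ : ∀ {R : ℕ → ℕ → Set} as {bs} cs {ds} → length as ≡ length cs →
                Pointwise R (as ++ bs) (cs ++ ds) → Pointwise R as cs × Pointwise R bs ds
Pointwise-++⁻ [] [] _ rs = [] , rs
Pointwise-++⁻ (_ ∷ as) (_ ∷ cs) eq (r ∷ rs) with Pointwise-++⁻ as cs (cong pred eq) rs
... | rs₁ , rs₂ = r ∷ rs₁ , rs₂

orderIso-[] : OrderIso [] []
orderIso-[] = refl , λ ()

orderIso-∷⁺ : Pointwise (Concordant x y) xs ys → OrderIso xs ys → OrderIso (x ∷ xs) (y ∷ ys)
orderIso-∷⁺ pw (eq , iso) = cong suc eq , λ where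
  fzero fzero → (λ x<x → ⊥-elim (<-irrefl refl x<x)) , (λ y<y → ⊥-elim (<-irrefl refl y<y))
  fzero (fsuc j) → proj₁ (lookup-cast pw eq j)
  (fsuc i) fzero → proj₂ (lookup-cast pw eq i)
  (fsuc i) (fsuc j) → iso i j

orderIso-∷⁻ : OrderIso (x ∷ xs) (y ∷ ys) → Pointwise (Concordant x y) xs ys × OrderIso xs ys
orderIso-∷⁻ {x = x} {xs = xs} {y = y} {ys = ys} (eq , iso) =
  lookup⁻ eq′ concordant , (eq′ , λ i j → iso (fsuc i) (fsuc j))
  where
  eq′ : length xs ≡ length ys
  eq′ = cong pred eq
  concordant : ∀ {i j} → toℕ i ≡ toℕ j → Concordant x y (lookup xs i) (lookup ys j)
  concordant {i} i≡j = subst (λ j → Concordant x y (lookup xs i) (lookup ys j))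
                             (toℕ-injective (trans (toℕ-cast eq′ i) i≡j))
                             (iso fzero (fsuc i) , iso (fsuc i) fzero)

Pointwise-concordant : All (x <_) xs → All (y <_) ys → length xs ≡ length ys → Pointwise (Concordant x y) xs ys
Pointwise-concordant [] [] _ = []
Pointwise-concordant (x<x′ ∷ xs>) (y<y′ ∷ ys>) eq =
  concordant-< x<x′ y<y′ ∷ Pointwise-concordant xs> ys> (cong pred eq)

All-concordant : Pointwise (Concordant x y) xs ys → All (y <_) ys → All (x <_) xs
All-concordant [] [] = []
All-concordant (c ∷ cs) (y<y′ ∷ ys>) = proj₂ (proj₁ c) y<y′ ∷ All-concordant cs ys>

orderIso-ascentThenDrop⁻ : ∀ {σ} fs → AllPairs _<_ fs → All (z <_) fs → OrderIso σ (fs ++ [ z ]) →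
  ∃₂ λ ys x → σ ≡ ys ++ [ x ] × length ys ≡ length fs × AllPairs _<_ ys × All (x <_) ys
orderIso-ascentThenDrop⁻ {σ = []} [] _ _ (() , _)
orderIso-ascentThenDrop⁻ {σ = x ∷ []} [] _ _ _ = [] , x , refl , refl , [] , []
orderIso-ascentThenDrop⁻ {σ = _ ∷ _ ∷ _} [] _ _ (() , _)
orderIso-ascentThenDrop⁻ {σ = []} (_ ∷ _) _ _ (() , _)
orderIso-ascentThenDrop⁻ {σ = y ∷ σ} (f ∷ fs) (f< ∷ fs↑) (z<f ∷ z<fs) iso
  with orderIso-∷⁻ iso
... | pw , iso′ with orderIso-ascentThenDrop⁻ {σ = σ} fs fs↑ z<fs iso′
...   | ys , x , refl , len , ys↑ , x<ys with Pointwise-++⁻ ys fs len pw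
...     | pw′ , (c ∷ []) =
  y ∷ ys , x , refl , cong suc len , All-concordant pw′ f< ∷ ys↑ , proj₂ (proj₂ c) z<f ∷ x<ys

orderIso-ascentThenDrop⁺ : ∀ {ys fs} → AllPairs _<_ ys → All (x <_) ys → AllPairs _<_ fs → All (z <_) fs →
  length ys ≡ length fs → OrderIso (ys ++ [ x ]) (fs ++ [ z ])
orderIso-ascentThenDrop⁺ {ys = []} {[]} _ _ _ _ _ = orderIso-∷⁺ [] orderIso-[]
orderIso-ascentThenDrop⁺ {ys = y ∷ ys} {f ∷ fs} (y< ∷ ys↑) (x<y ∷ x<ys) (f< ∷ fs↑) (z<f ∷ z<fs) eq =
  orderIso-∷⁺ (Pointwise-++⁺ (Pointwise-concordant y< f< eq′) (concordant-> x<y z<f ∷ []))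
              (orderIso-ascentThenDrop⁺ ys↑ x<ys fs↑ z<fs eq′)
  where
  eq′ : length ys ≡ length fs
  eq′ = cong pred eq

Before-⊆ : (u ∷ ws) ⊆ xs → v ∈ ws → Before xs u v
Before-⊆ (_ ∷ʳ s) v∈ = later (Before-⊆ s v∈)
Before-⊆ (refl ∷ s) v∈ = first (Sublist.lookup s v∈)

Before-∷-⊆ : Unique xs → Before xs u v → (v ∷ ws) ⊆ xs → (u ∷ v ∷ ws) ⊆ xs
Before-∷-⊆ _ (first _) (_ ∷ʳ s) = refl ∷ s
Before-∷-⊆ U (first v∈) (refl ∷ _) = ⊥-elim (Unique[x∷xs]⇒x∉xs U v∈)
Before-∷-⊆ (_ ∷ U) (later b) (_ ∷ʳ s) = _ ∷ʳ Before-∷-⊆ U b s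
Before-∷-⊆ U (later b) (refl ∷ _) = ⊥-elim (Unique[x∷xs]⇒x∉xs U (Before⇒∈ʳ b))

Ascent-⊆ : ∀ zs → (y ∷ zs ++ [ x ]) ⊆ xs → AllPairs _<_ (y ∷ zs) → Ascent xs (Precedes xs x) (length zs) y
Ascent-⊆ [] s _ = done (Before-⊆ s (here refl))
Ascent-⊆ (z ∷ zs) s ((y<z ∷ _) ∷ zs↑) = step y<z (Before-⊆ s (here refl)) (Ascent-⊆ zs (∷ˡ⁻ s) zs↑)

Ascent⇒⊆ : Unique xs → Ascent xs (Precedes xs x) k y → x < y →
  ∃ λ zs → (y ∷ zs ++ [ x ]) ⊆ xs × AllPairs _<_ (y ∷ zs) × All (x <_) (y ∷ zs) × length zs ≡ k
Ascent⇒⊆ U (done y≺x) x<y = [] , Before-∷-⊆ U y≺x (from∈ (Before⇒∈ʳ y≺x)) , [] ∷ [] , x<y ∷ [] , refl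
Ascent⇒⊆ U (step y<y′ y≺y′ rest) x<y with Ascent⇒⊆ U rest (<-trans x<y y<y′)
... | zs , s , (y′< ∷ zs↑) , x<zs , len =
  _ ∷ zs , Before-∷-⊆ U y≺y′ s , (y<y′ ∷ All.map (<-trans y<y′) y′<) ∷ y′< ∷ zs↑ ,
  x<y ∷ x<zs , cong suc len

longPat-rise : ℕ → List ℕ
longPat-rise t = applyUpTo (λ i → i + 2) (suc t)

longPat-rise-ascending : ∀ t → AllPairs _<_ (longPat-rise t)
longPat-rise-ascending t = AllPairs.applyUpTo⁺₁ _ (suc t) (λ i<j _ → +-monoˡ-< 2 i<j)

longPat-rise-above1 : ∀ t → All (1 <_) (longPat-rise t)
longPat-rise-above1 t = applyUpTo⁺₂ _ (suc t) (m≤n+m 2)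

Contains-longPat⇔HasLongPat : ∀ t → Unique xs → Contains xs (longPat t) ⇔ HasLongPat xs t
Contains-longPat⇔HasLongPat {xs} t U = mk⇔ occurrence⇒ ⇒occurrence
  where
  rise↑ : AllPairs _<_ (longPat-rise t)
  rise↑ = longPat-rise-ascending t
  rise>1 : All (1 <_) (longPat-rise t)
  rise>1 = longPat-rise-above1 t
  occurrence⇒ : Contains xs (longPat t) → HasLongPat xs t
  occurrence⇒ (σ , σ⊆ , iso) with orderIso-ascentThenDrop⁻ {σ = σ} (longPat-rise t) rise↑ rise>1 iso
  ... | [] , _ , _ , () , _
  ... | y ∷ zs , x , refl , len , ys↑ , (x<y ∷ _) =
    x , y , x<y , subst (λ k → Ascent xs (Precedes xs x) k y) (trans (cong pred len) (length-applyUpTo _ t))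
                        (Ascent-⊆ zs σ⊆ ys↑)
  ⇒occurrence : HasLongPat xs t → Contains xs (longPat t)
  ⇒occurrence (x , y , x<y , asc) with Ascent⇒⊆ U asc x<y
  ... | zs , σ⊆ , ys↑ , x<ys , len =
    y ∷ zs ++ [ x ] , σ⊆ ,
    orderIso-ascentThenDrop⁺ ys↑ x<ys rise↑ rise>1 (cong suc (trans len (sym (length-applyUpTo _ t))))

Avoids213⇒No213 : Unique xs → Avoids xs p213 → No213 xs
Avoids213⇒No213 U avoids a≺b b≺c b<a a<c =
  avoids (_ , Before-∷-⊆ U a≺b (Before-∷-⊆ U b≺c (from∈ (Before⇒∈ʳ b≺c))) ,
          orderIso-∷⁺ (concordant-> b<a (s<s z<s) ∷ concordant-< a<c (s<s (s<s z<s)) ∷ [])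
                      (orderIso-∷⁺ (concordant-< (<-trans b<a a<c) (s<s z<s) ∷ []) (orderIso-∷⁺ [] orderIso-[])))

module MinPivot (α : List ℕ) (m : ℕ) (β : List ℕ) (U : Unique (α ++ m ∷ β))
                (no213 : No213 (α ++ m ∷ β)) (m-min : All (m ≤_) (α ++ m ∷ β)) where

  open AroundPivot α m β U public

  No213ˡ : No213 α
  No213ˡ a≺b b≺c = no213 (liftˡ a≺b) (liftˡ b≺c)

  No213ʳ : No213 β
  No213ʳ a≺b b≺c = no213 (liftʳ a≺b) (liftʳ b≺c)

  pivot<ˡ : u ∈ α → m < u
  pivot<ˡ u∈ = ≤∧≢⇒< (All.lookup m-min (∈-++⁺ˡ u∈)) (λ m≡u → m∉α u∈ (sym m≡u))

  pivot<ʳ : u ∈ β → m < u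
  pivot<ʳ u∈ = ≤∧≢⇒< (All.lookup m-min (∈-++⁺ʳ α (there u∈))) (λ m≡u → m∉β u∈ (sym m≡u))

  -- a letter of α below a letter of β would form a 213 with the pivot
  right<left : u ∈ α → v ∈ β → v < u
  right<left {u} {v} u∈ v∈ with <-cmp u v
  ... | tri< u<v _ _ = ⊥-elim (no213 (Before-++⁺ u∈ (here refl)) (Before-++⁺ʳ α (first v∈)) (pivot<ˡ u∈) u<v)
  ... | tri≈ _ refl _ = ⊥-elim (Unique-++-disjoint α U u∈ (there v∈))
  ... | tri> _ _ v<u = v<u

  Ascent-restrictˡ : (∀ {z} → P z → Q z) → (∀ {z} → Q z → z ∈ α) →
                     Ascent (α ++ m ∷ β) P k y → Ascent α Q k y
  Ascent-restrictˡ f g (done p) = done (f p)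
  Ascent-restrictˡ f g (step y<y′ y≺y′ rest) =
    let rest′ = Ascent-restrictˡ f g rest in step y<y′ (restrictˡ y≺y′ (Ascent-head g rest′)) rest′

  Ascent-restrictʳ : (∀ {z} → z ∈ β → P z → Q z) → Ascent (α ++ m ∷ β) P k y → y ∈ β → Ascent β Q k y
  Ascent-restrictʳ f (done p) y∈ = done (f y∈ p)
  Ascent-restrictʳ f (step y<y′ y≺y′ rest) y∈ =
    let y≺y′′ = restrictʳ y≺y′ y∈ in step y<y′ y≺y′′ (Ascent-restrictʳ f rest (Before⇒∈ʳ y≺y′′))

  Ascent-fromˡ : Ascent (α ++ m ∷ β) P k y → y ∈ α → Ascent α (_∈ α) k y
  Ascent-fromˡ (done _) y∈ = done y∈
  Ascent-fromˡ (step y<y′ y≺y′ rest) y∈ with ∈-split (Before⇒∈ʳ y≺y′)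
  ... | inj₁ y′∈α = step y<y′ (restrictˡ y≺y′ y′∈α) (Ascent-fromˡ rest y′∈α)
  ... | inj₂ (inj₁ refl) = ⊥-elim (<-asym y<y′ (pivot<ˡ y∈))
  ... | inj₂ (inj₂ y′∈β) = ⊥-elim (<-asym y<y′ (right<left y∈ y′∈β))

  HasLongPat-split : HasLongPat (α ++ m ∷ β) k → (HasLongPat α k ⊎ HasAscent α k) ⊎ HasLongPat β k
  HasLongPat-split (x , y , x<y , asc) with ∈-split (Before⇒∈ʳ (Ascent-last U asc))
  ... | inj₁ x∈α = inj₁ (inj₁ (x , y , x<y , Ascent-restrictˡ (λ z≺x → restrictˡ z≺x x∈α) Before⇒∈ˡ asc))
  ... | inj₂ (inj₁ refl) = inj₁ (inj₂ (y , Ascent-restrictˡ Before-pivot⇒∈ˡ (λ z∈ → z∈) asc))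
  ... | inj₂ (inj₂ x∈β) with ∈-split (Ascent-head Before⇒∈ˡ asc)
  ...   | inj₁ y∈α = inj₁ (inj₂ (y , Ascent-fromˡ asc y∈α))
  ...   | inj₂ (inj₁ refl) = ⊥-elim (<-asym x<y (pivot<ʳ x∈β))
  ...   | inj₂ (inj₂ y∈β) = inj₂ (x , y , x<y , Ascent-restrictʳ (λ z∈ z≺x → restrictʳ z≺x z∈) asc y∈β)

  HasLongPat-liftˡ : HasLongPat α k → HasLongPat (α ++ m ∷ β) k
  HasLongPat-liftˡ (x , y , x<y , asc) = x , y , x<y , Ascent-map liftˡ liftˡ asc

  HasLongPat-liftʳ : HasLongPat β k → HasLongPat (α ++ m ∷ β) k
  HasLongPat-liftʳ (x , y , x<y , asc) = x , y , x<y , Ascent-map liftʳ liftʳ asc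

  HasAscent⇒HasLongPat : HasAscent α k → HasLongPat (α ++ m ∷ β) k
  HasAscent⇒HasLongPat (y , asc) =
    m , y , pivot<ˡ (Ascent-head (λ z∈ → z∈) asc) , Ascent-map liftˡ (λ z∈ → Before-++⁺ z∈ (here refl)) asc

  HasAscent-split : HasAscent (α ++ m ∷ β) k →
                    HasAscent α k ⊎ k ≡ 0 ⊎ ∃ λ k′ → k ≡ suc k′ × HasAscent β k′
  HasAscent-split (y , asc) with ∈-split (Ascent-head (λ z∈ → z∈) asc)
  ... | inj₁ y∈α = inj₁ (y , Ascent-fromˡ asc y∈α)
  HasAscent-split (_ , done _) | inj₂ (inj₁ refl) = inj₂ (inj₁ refl)
  HasAscent-split (_ , step _ m≺y′ rest) | inj₂ (inj₁ refl) =
    inj₂ (inj₂ (_ , refl , _ , Ascent-restrictʳ (λ z∈ _ → z∈) rest (pivot-Before⇒∈ʳ m≺y′)))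
  HasAscent-split {zero} _ | inj₂ (inj₂ y∈β) = inj₂ (inj₁ refl)
  HasAscent-split {suc k} (y , asc) | inj₂ (inj₂ y∈β) =
    inj₂ (inj₂ (k , refl , HasAscent-pred (y , Ascent-restrictʳ (λ z∈ _ → z∈) asc y∈β)))

  HasAscent-liftˡ : HasAscent α k → HasAscent (α ++ m ∷ β) k
  HasAscent-liftˡ (y , asc) = y , Ascent-map liftˡ ∈-++⁺ˡ asc

  HasAscent-liftʳ : HasAscent β k → HasAscent (α ++ m ∷ β) k
  HasAscent-liftʳ (y , asc) = y , Ascent-map liftʳ (λ z∈ → ∈-++⁺ʳ α (there z∈)) asc

  HasAscent-pivot : HasAscent (α ++ m ∷ β) 0
  HasAscent-pivot = m , done (∈-++⁺ʳ α (here refl))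

  HasAscent-pivot∷ : HasAscent β k → HasAscent (α ++ m ∷ β) (suc k)
  HasAscent-pivot∷ (y , asc) =
    m , step (pivot<ʳ y∈) (Before-++⁺ʳ α (first y∈)) (proj₂ (HasAscent-liftʳ (y , asc)))
    where
    y∈ : y ∈ β
    y∈ = Ascent-head (λ z∈ → z∈) asc

≤-⊔⁻ : ∀ a b → k ≤ a ⊔ b → k ≤ a ⊎ k ≤ b
≤-⊔⁻ {k} a b k≤ with ⊔-sel a b
... | inj₁ a⊔b≡a = inj₁ (subst (k ≤_) a⊔b≡a k≤)
... | inj₂ a⊔b≡b = inj₂ (subst (k ≤_) a⊔b≡b k≤)

HasAscent-⊔ : ∀ {a b} → HasAscent xs a → HasAscent xs b → HasAscent xs (a ⊔ b)
HasAscent-⊔ {a = a} {b} ascᵃ ascᵇ with ⊔-sel a b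
... | inj₁ a⊔b≡a = subst (HasAscent _) (sym a⊔b≡a) ascᵃ
... | inj₂ a⊔b≡b = subst (HasAscent _) (sym a⊔b≡b) ascᵇ

maxRootR-left≤ : ∀ L m R → maxRootR L ≤ maxRootR (node L m R)
maxRootR-left≤ L m leaf = ≤-refl
maxRootR-left≤ L m (node _ _ _) = m≤m⊔n _ _

HasAscent⇒≤maxRootR : ∀ {T} → IsMinTree xs T → Unique xs → No213 xs → HasAscent xs k → k ≤ maxRootR T
HasAscent⇒≤maxRootR leaf _ _ asc = ⊥-elim (HasAscent-[] asc)
HasAscent⇒≤maxRootR {k = k} (node {α = α} {m} {β} {L} {R} refl m-min tα tβ) U no213 asc =
  bound tβ (HasAscent-split asc)
  where
  open MinPivot α m β U no213 m-min
  bound : IsMinTree β R → HasAscent α k ⊎ k ≡ 0 ⊎ (∃ λ k′ → k ≡ suc k′ × HasAscent β k′) →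
          k ≤ maxRootR (node L m R)
  bound _ (inj₁ ascˡ) = ≤-trans (HasAscent⇒≤maxRootR tα Uα No213ˡ ascˡ) (maxRootR-left≤ L m R)
  bound _ (inj₂ (inj₁ refl)) = z≤n
  bound leaf (inj₂ (inj₂ (_ , refl , ascʳ))) = ⊥-elim (HasAscent-[] ascʳ)
  bound tβ@(node _ _ _ _) (inj₂ (inj₂ (_ , refl , ascʳ))) =
    m≤n⇒m≤o⊔n _ (s≤s (HasAscent⇒≤maxRootR tβ Uβ No213ʳ ascʳ))

HasAscent-maxRootR : ∀ {L R} → IsMinTree xs (node L m R) → Unique xs → No213 xs → HasAscent xs (maxRootR (node L m R))
HasAscent-maxRootR {L = L} (node {α = α} {m} {β} refl m-min tα tβ) U no213 = combine tβ
  where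
  open MinPivot α m β U no213 m-min
  ascentˡ : ∀ {L} → IsMinTree α L → HasAscent (α ++ m ∷ β) (maxRootR L)
  ascentˡ leaf = HasAscent-pivot
  ascentˡ tα@(node _ _ _ _) = HasAscent-liftˡ (HasAscent-maxRootR tα Uα No213ˡ)
  combine : ∀ {R} → IsMinTree β R → HasAscent (α ++ m ∷ β) (maxRootR (node L m R))
  combine leaf = ascentˡ tα
  combine tβ@(node _ _ _ _) = HasAscent-⊔ (ascentˡ tα) (HasAscent-pivot∷ (HasAscent-maxRootR tβ Uβ No213ʳ))

HasAscent⇔≤maxRootR : ∀ {L R} → IsMinTree xs (node L m R) → Unique xs → No213 xs →
                      HasAscent xs k ⇔ k ≤ maxRootR (node L m R)
HasAscent⇔≤maxRootR t U no213 =
  mk⇔ (HasAscent⇒≤maxRootR t U no213) (λ k≤ → HasAscent-≤ k≤ (HasAscent-maxRootR t U no213))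

HasLongPat⊎HasAscent⇔≤maxAnyR : ∀ {T} → IsMinTree xs T → Unique xs → No213 xs → 1 ≤ k →
                                (HasLongPat xs k ⊎ HasAscent xs k) ⇔ k ≤ maxAnyR T
HasLongPat⊎HasAscent⇔≤maxAnyR leaf _ _ 1≤k =
  mk⇔ (λ { (inj₁ long) → ⊥-elim (HasLongPat-[] long) ; (inj₂ asc) → ⊥-elim (HasAscent-[] asc) })
      (λ k≤0 → ⊥-elim (<⇒≱ 1≤k k≤0))
HasLongPat⊎HasAscent⇔≤maxAnyR {k = k} t@(node {α = α} {m} {β} {L} {R} refl m-min tα tβ) U no213 1≤k =
  mk⇔ to from
  where
  open MinPivot α m β U no213 m-min
  IHˡ : (HasLongPat α k ⊎ HasAscent α k) ⇔ k ≤ maxAnyR L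
  IHˡ = HasLongPat⊎HasAscent⇔≤maxAnyR tα Uα No213ˡ 1≤k
  IHʳ : (HasLongPat β k ⊎ HasAscent β k) ⇔ k ≤ maxAnyR R
  IHʳ = HasLongPat⊎HasAscent⇔≤maxAnyR tβ Uβ No213ʳ 1≤k
  root : HasAscent (α ++ m ∷ β) k ⇔ k ≤ maxRootR (node L m R)
  root = HasAscent⇔≤maxRootR t U no213
  to : HasLongPat (α ++ m ∷ β) k ⊎ HasAscent (α ++ m ∷ β) k → k ≤ maxAnyR (node L m R)
  to (inj₂ asc) = m≤n⇒m≤n⊔o _ (m≤n⇒m≤n⊔o _ (Equivalence.to root asc))
  to (inj₁ long) with HasLongPat-split long
  ... | inj₁ occˡ = m≤n⇒m≤n⊔o (maxAnyR R) (m≤n⇒m≤o⊔n (maxRootR (node L m R)) (Equivalence.to IHˡ occˡ))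
  ... | inj₂ longʳ = m≤n⇒m≤o⊔n _ (Equivalence.to IHʳ (inj₁ longʳ))
  from : k ≤ maxAnyR (node L m R) → HasLongPat (α ++ m ∷ β) k ⊎ HasAscent (α ++ m ∷ β) k
  from k≤ with ≤-⊔⁻ _ _ k≤
  ... | inj₂ k≤ʳ = Sum.map HasLongPat-liftʳ HasAscent-liftʳ (Equivalence.from IHʳ k≤ʳ)
  ... | inj₁ k≤ with ≤-⊔⁻ _ _ k≤
  ...   | inj₁ k≤root = inj₂ (Equivalence.from root k≤root)
  ...   | inj₂ k≤ˡ = Sum.map HasLongPat-liftˡ HasAscent-liftˡ (Equivalence.from IHˡ k≤ˡ)

HasLongPat⇔≤restrictedMax : ∀ {T} → IsMinTree xs T → Unique xs → No213 xs → 1 ≤ k →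
                            HasLongPat xs k ⇔ k ≤ restrictedMax T
HasLongPat⇔≤restrictedMax leaf _ _ 1≤k =
  mk⇔ (λ long → ⊥-elim (HasLongPat-[] long)) (λ k≤0 → ⊥-elim (<⇒≱ 1≤k k≤0))
HasLongPat⇔≤restrictedMax {k = k} (node {α = α} {m} {β} {L} {R} refl m-min tα tβ) U no213 1≤k = mk⇔ to from
  where
  open MinPivot α m β U no213 m-min
  left : (HasLongPat α k ⊎ HasAscent α k) ⇔ k ≤ maxAnyR L
  left = HasLongPat⊎HasAscent⇔≤maxAnyR tα Uα No213ˡ 1≤k
  IHʳ : HasLongPat β k ⇔ k ≤ restrictedMax R
  IHʳ = HasLongPat⇔≤restrictedMax tβ Uβ No213ʳ 1≤k
  to : HasLongPat (α ++ m ∷ β) k → k ≤ restrictedMax (node L m R)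
  to long with HasLongPat-split long
  ... | inj₁ occˡ = m≤n⇒m≤n⊔o _ (Equivalence.to left occˡ)
  ... | inj₂ longʳ = m≤n⇒m≤o⊔n _ (Equivalence.to IHʳ longʳ)
  from : k ≤ restrictedMax (node L m R) → HasLongPat (α ++ m ∷ β) k
  from k≤ with ≤-⊔⁻ _ _ k≤
  ... | inj₁ k≤ˡ = Sum.[ HasLongPat-liftˡ , HasAscent⇒HasLongPat ] (Equivalence.from left k≤ˡ)
  ... | inj₂ k≤ʳ = HasLongPat-liftʳ (Equivalence.from IHʳ k≤ʳ)

restrictedMax-noLeftEdge : ∀ T → hasLeftEdge T ≡ false → restrictedMax T ≡ 0
restrictedMax-noLeftEdge leaf _ = refl
restrictedMax-noLeftEdge (node leaf _ R) none = restrictedMax-noLeftEdge R none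

lrrp≤⇔restrictedMax< : ∀ T {t} → 1 ≤ t → lrrp T ≤ t ⇔ restrictedMax T < t
lrrp≤⇔restrictedMax< T {t} 1≤t with hasLeftEdge T in eq
... | true = ⇔.refl
... | false = mk⇔ (λ _ → subst (_< t) (sym (restrictedMax-noLeftEdge T eq)) 1≤t) (λ _ → z≤n)

¬-⇔ : ∀ {A B : Set} → A ⇔ B → (¬ A) ⇔ (¬ B)
¬-⇔ A⇔B = mk⇔ (contraposition (Equivalence.from A⇔B)) (contraposition (Equivalence.to A⇔B))

≰⇔> : ∀ {a b} → (¬ a ≤ b) ⇔ b < a
≰⇔> = mk⇔ ≰⇒> (λ b<a a≤b → <⇒≱ b<a a≤b)

proposition4p1 : (t n : ℕ) → 1 ≤ t → (π : List ℕ) → IsPerm n π → Avoids π p213 →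
    (Avoids π (longPat t) ⇔ lrrp (lam π) ≤ t)
    × (stackIter t π ≡ idPerm n ⇔ Avoids π (longPat t))
proposition4p1 t n 1≤t π π↭id avoids213 = avoidance⇔lrrp , sorted⇔avoidance
  where
  U : Unique π
  U = Unique-resp-↭ (↭-sym π↭id) (Unique-idPerm n)
  no213 : No213 π
  no213 = Avoids213⇒No213 U avoids213
  avoidance⇔noLongPat : Avoids π (longPat t) ⇔ (¬ HasLongPat π t)
  avoidance⇔noLongPat = ¬-⇔ (Contains-longPat⇔HasLongPat t U)
  avoidance⇔lrrp : Avoids π (longPat t) ⇔ lrrp (lam π) ≤ t
  avoidance⇔lrrp = begin
    Avoids π (longPat t)            ≈⟨ avoidance⇔noLongPat ⟩
    (¬ HasLongPat π t)              ≈⟨ ¬-⇔ (HasLongPat⇔≤restrictedMax (lam-isMinTree π) U no213 1≤t) ⟩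
    (¬ t ≤ restrictedMax (lam π))   ≈⟨ ≰⇔> ⟩
    (restrictedMax (lam π) < t)     ≈⟨ lrrp≤⇔restrictedMax< (lam π) 1≤t ⟨
    (lrrp (lam π) ≤ t)              ∎
  sorted⇔avoidance : stackIter t π ≡ idPerm n ⇔ Avoids π (longPat t)
  sorted⇔avoidance = begin
    (stackIter t π ≡ idPerm n)       ≈⟨ ≡idPerm⇔¬HasLongPat n (↭-trans (stackIter-↭ t π) π↭id) ⟩
    (¬ HasLongPat (stackIter t π) 0) ≈⟨ ¬-⇔ (HasLongPat-stackIter t U (No213⇒No3241 no213)) ⟩
    (¬ HasLongPat π (t + 0))         ≡⟨ cong (λ k → ¬ HasLongPat π k) (+-identityʳ t) ⟩
    (¬ HasLongPat π t)               ≈⟨ avoidance⇔noLongPat ⟨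
    Avoids π (longPat t)             ∎
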